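{- Let $p^G\colon G\to\Sigma$ and $p^H\colon H\to\Sigma$ be graphs over $\Sigma$, equipped with testing relations making $\mathsf{fc}(p^G)$ and $\mathsf{fc}(p^H)$ into (free) graphs with testing, and let $R\subseteq\mathrm{ob}(G)\times\mathrm{ob}(H)$ be a weakly fair relation. If $x\,R\,y$ and $x'\,R\,y'$, then $x\simeq_{\mathsf{fc}(G)}x'$ if and only if $y\simeq_{\mathsf{fc}(H)}y'$.
   Context: All graphs are reflexive (each vertex has an identity edge, preserved by morphisms). Convention: we write $x\xleftarrow{a}y$ if there is an edge $e\colon y\to x$ with $p(e)=a$, and $x\leftarrow y$ if $a$ is an identity. $\Sigma$ is the reflexive graph with one vertex and endo-edges $\tau$ (the identity) and $\heartsuit$. For a graph $G$, $\mathsf{fc}(G)$ is the free category on $G$ (same vertices; morphisms are finite paths of non-identity edges, identities are empty paths) viewed as a reflexive graph, and for $p\colon G\to\Sigma$, $\mathsf{fc}(p)\colon\mathsf{fc}(G)\to\mathsf{fc}(\Sigma)$ maps a path to the concatenation of images of its edges with identities deleted; $\mathsf{fc}(\Sigma)$ has one vertex and edges $\heartsuit^k$, $k\ge0$. Strong bisimilarity $\sim_{\mathsf{fc}(\Sigma)}$ between vertices of graphs over $\mathsf{fc}(\Sigma)$ is the largest relation $S$ such that if $x\,S\,y$ and $x\xleftarrow{a}x'$ then $y\xleftarrow{a}y'$ with $x'\,S\,y'$, and symmetrically. For graphs over $\Sigma$, write $x\overset{\rho}{\Longleftarrow}y$ if there is a path of edges from $y$ to $x$ whose labels, with identities deleted,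 equal $\rho$ with identities deleted; weak bisimilarity $\approx_\Sigma$ is the largest relation $S$ such that if $x\,S\,y$ and $x\xleftarrow{a}x'$ ($a\in\{\tau,\heartsuit\}$) then $y\overset{a}{\Longleftarrow}y'$ with $x'\,S\,y'$, and symmetrically. A graph with testing is a graph $K$ with $p\colon K\to\mathsf{fc}(\Sigma)$ and a relation $(\mathrm{ob}(K))^2\to\mathrm{ob}(K)$, written $z\in(x\mid_K y)$, whose domain, denoted $\mathrel{\mathrm{coh}_K}$, is an equivalence relation and such that $z,z'\in(x\mid_K y)$ implies $z\sim_{\mathsf{fc}(\Sigma)}z'$; a global choice of an element of $(x\mid_K y)$ is fixed and $(x\mid_K y)$ denotes it. It is free if it has the form $\mathsf{fc}(p^G)$ for some $p^G\colon G\to\Sigma$ (with testing relation on $\mathrm{ob}(G)$). $\bot^K$ is the set of vertices $x$ such that for every $x\leftarrow x'$ there is $x'\xleftarrow{\heartsuit}x''$ ($\heartsuit=\heartsuit^1$). Fair testing equivalence: $x\simeq_K y$ iff $x\mathrel{\mathrm{coh}_K}y$ and for all $z\mathrel{\mathrm{coh}_K}x$, $(x\mid_K z)\in\bot^K$ iff $(y\mid_K z)\in\bot^K$. A relation $R\subseteq\mathrm{ob}(G)\times\mathrm{ob}(H)$ between the vertex sets of two free graphs with testing generated by $p^G$ and $p^H$ is weakly fair iff: (i) $x\,R\,y$ and $x'\,R\,y'$ imply ($x\mathrel{\mathrm{coh}}x'\iff y\mathrel{\mathrm{coh}}y'$); (ii) $R$ is total and surjective; (iii) $x\,R\,y$ implies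 $x\approx_\Sigma y$; (iv) if $x\,R\,y$, $x'\,R\,y'$ and $x\mathrel{\mathrm{coh}}x'$, then there exist $u\in(x\mid x')$ and $v\in(y\mid y')$ with $u\,R\,v$. -}

module Defs where

open import Data.Nat using (ℕ; zero; suc)
open import Data.Product using (Σ; ∃; ∃-syntax; _×_; _,_)
open import Function.Bundles using (_⇔_)
open import Relation.Binary.Structures using (IsEquivalence)

-- Non-identity labels of Σ: the identity τ and the edge ♡.
data Lab : Set where
  τ ♡ : Lab

-- A reflexive graph over Σ.  'step x a x′' means  x ←[a] x′ , i.e. there is an
-- edge e : x′ → x with p(e) = a.  Identity edges need not be listed (they only
-- add τ-loops, which change none of the notions below).
record GraphΣ : Set₁ where
  field
    V    : Set
    step : V → Lab → V → Set

module _ (G : GraphΣ) where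
  open GraphΣ G

  -- Path x k y : a path of edges from y to x containing exactly k ♡-edges,
  -- i.e. an edge  x ←[♡^k] y  of fc(G) over fc(Σ).
  data Path : V → ℕ → V → Set where
    nil  : ∀ {x} → Path x zero x
    τcons : ∀ {x x₁ k y} → step x τ x₁ → Path x₁ k y → Path x k y
    ♡cons : ∀ {x x₁ k y} → step x ♡ x₁ → Path x₁ k y → Path x (suc k) y

♯ : Lab → ℕ
♯ τ = zero
♯ ♡ = suc zero

-- Weak bisimulation / bisimilarity ≈_Σ between vertices of two graphs over Σ
-- (x ⇐[a] y  is  Path _ x (♯ a) y).
IsWeakBisim : (G H : GraphΣ) → (GraphΣ.V G → GraphΣ.V H → Set) → Set
IsWeakBisim G H S =
  (∀ {x y a x′} → S x y → GraphΣ.step G x a x′ →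
     ∃[ y′ ] (Path H y (♯ a) y′ × S x′ y′)) ×
  (∀ {x y a y′} → S x y → GraphΣ.step H y a y′ →
     ∃[ x′ ] (Path G x (♯ a) x′ × S x′ y′))

_≈Σ_ : {G H : GraphΣ} → GraphΣ.V G → GraphΣ.V H → Set₁
_≈Σ_ {G} {H} x y = Σ (GraphΣ.V G → GraphΣ.V H → Set) λ S → IsWeakBisim G H S × S x y

IsStrongBisimFc : (G H : GraphΣ) → (GraphΣ.V G → GraphΣ.V H → Set) → Set
IsStrongBisimFc G H S =
  (∀ {x y k x′} → S x y → Path G x k x′ → ∃[ y′ ] (Path H y k y′ × S x′ y′)) ×
  (∀ {x y k y′} → S x y → Path H y k y′ → ∃[ x′ ] (Path G x k x′ × S x′ y′))

_∼fc_ : {G H : GraphΣ} → GraphΣ.V G → GraphΣ.V H → Set₁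
_∼fc_ {G} {H} x y = Σ (GraphΣ.V G → GraphΣ.V H → Set) λ S → IsStrongBisimFc G H S × S x y

-- A testing relation on the vertices of G making fc(G) a (free) graph with testing.
-- 'test z x y' means z ∈ (x | y); 'sel x y' is the globally chosen element of
-- (x | y), meaningful when x coh y.
record Testing (G : GraphΣ) : Set₁ where
  open GraphΣ G
  field
    test : V → V → V → Set
  Coh : V → V → Set
  Coh x y = ∃[ z ] test z x y
  field
    coh-equiv : IsEquivalence Coh
    test-bisim : ∀ {x y z z′} → test z x y → test z′ x y → _∼fc_ {G} {G} z z′
    sel : V → V → V
    sel-spec : ∀ {x y} → Coh x y → test (sel x y) x y

Bot : (G : GraphΣ) → GraphΣ.V G → Set
Bot G x = ∀ x′ → Path G x zero x′ → ∃[ x″ ] Path G x′ (suc zero) x″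

FairEq : (G : GraphΣ) (T : Testing G) → GraphΣ.V G → GraphΣ.V G → Set
FairEq G T x y =
  Coh x y × (∀ z → Coh z x → (Bot G (sel x z) ⇔ Bot G (sel y z)))
  where open Testing T

record WeaklyFair (G H : GraphΣ) (TG : Testing G) (TH : Testing H)
                  (R : GraphΣ.V G → GraphΣ.V H → Set) : Set₁ where
  module TG = Testing TG
  module TH = Testing TH
  field
    coh-iff : ∀ {x y x′ y′} → R x y → R x′ y′ → (TG.Coh x x′ ⇔ TH.Coh y y′)
    total : ∀ x → ∃[ y ] R x y
    surjective : ∀ y → ∃[ x ] R x y
    weak-bisim : ∀ {x y} → R x y → _≈Σ_ {G} {H} x y
    test-rel : ∀ {x y x′ y′} → R x y → R x′ y′ → TG.Coh x x′ →
               ∃[ u ] ∃[ v ] (TG.test u x x′ × TH.test v y y′ × R u v)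

module Submission where

-- The only observation made by fair testing is membership of the chosen test
-- results  (x | z)  in  ⊥ , so the proof reduces to showing that ⊥ is respected
-- by every relation occurring in the definition of a weakly fair relation R:
--
--   * ⊥ is defined by paths of fc(G), hence invariant under strong bisimilarity
--     of free categories ∼fc  (this covers the choice among elements of (x | z));
--   * a weak bisimulation over Σ lifts, edge by edge, to a strong bisimulation
--     between the free categories, so ⊥ is also invariant under ≈Σ  (this covers R).
--
-- Given x R y, x′ R y′ and a test w on the H side, surjectivity of R provides a
-- z with z R w; clause (iv) of weak fairness relates (x | z) to (y | w) and
-- (x′ | z) to (y′ | w) through R, and the fair-testing hypothesis on x, x′ closes
-- the chain of ⇔'s.  The converse direction is the same argument applied to the
-- transposed relation, which is again weakly fair.

open import Defs
open import Data.Nat using (_+_)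
open import Data.Product using (∃-syntax; _×_; _,_)
open import Function.Base using (flip)
open import Function.Bundles using (_⇔_; mk⇔; Equivalence)
import Function.Properties.Equivalence as ⇔
open import Level using (0ℓ)
open import Relation.Binary.Structures using (IsEquivalence)
import Relation.Binary.Reasoning.Setoid as SetoidReasoning

_++ᵖ_ : ∀ {G x k y m z} → Path G x k y → Path G y m z → Path G x (k + m) z
nil       ++ᵖ q = q
τcons s p ++ᵖ q = τcons s (p ++ᵖ q)
♡cons s p ++ᵖ q = ♡cons s (p ++ᵖ q)

WeakSim : (G H : GraphΣ) → (GraphΣ.V G → GraphΣ.V H → Set) → Set
WeakSim G H S = ∀ {x y a x′} → S x y → GraphΣ.step G x a x′ →
                ∃[ y′ ] (Path H y (♯ a) y′ × S x′ y′)

StrongSimFc : (G H : GraphΣ) → (GraphΣ.V G → GraphΣ.V H → Set) → Set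
StrongSimFc G H S = ∀ {x y k x′} → S x y → Path G x k x′ →
                    ∃[ y′ ] (Path H y k y′ × S x′ y′)

-- A weak simulation over Σ is a strong simulation of the free categories:
-- simulate a path edge by edge and concatenate the matching paths.
weakSim⇒strongSimFc : ∀ {G H S} → WeakSim G H S → StrongSimFc G H S
weakSim⇒strongSimFc sim s nil = _ , nil , s
weakSim⇒strongSimFc sim s (τcons e p) with sim s e
... | _ , q , s₁ with weakSim⇒strongSimFc sim s₁ p
...   | y′ , q′ , s′ = y′ , q ++ᵖ q′ , s′
weakSim⇒strongSimFc sim s (♡cons e p) with sim s e
... | _ , q , s₁ with weakSim⇒strongSimFc sim s₁ p
...   | y′ , q′ , s′ = y′ , q ++ᵖ q′ , s′

weak⇒strong : ∀ {G H S} → IsWeakBisim G H S → IsStrongBisimFc G H S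
weak⇒strong {G} {H} {S} (fwd , bwd) =
  weakSim⇒strongSimFc fwd , weakSim⇒strongSimFc {H} {G} {flip S} bwd

strongBisim-flip : ∀ {G H S} → IsStrongBisimFc G H S → IsStrongBisimFc H G (flip S)
strongBisim-flip (fwd , bwd) = bwd , fwd

-- ⊥ is preserved by strong bisimulations: a τ-path from z′ is matched from z,
-- where ⊥ provides a ♡-edge, which is matched back from the end of the τ-path.
bot-transfer : ∀ {G H S} → IsStrongBisimFc G H S →
               ∀ {z z′} → S z z′ → Bot G z → Bot H z′
bot-transfer (fwd , bwd) s botz w τpath with bwd s τpath
... | v , τpath′ , svw with botz v τpath′
...   | _ , ♡edge with fwd svw ♡edge
...     | w′ , ♡edge′ , _ = w′ , ♡edge′

bot-invariant : ∀ {G H S} → IsStrongBisimFc G H S →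
                ∀ {z z′} → S z z′ → Bot G z ⇔ Bot H z′
bot-invariant B s = mk⇔ (bot-transfer B s) (bot-transfer (strongBisim-flip B) s)

bot-∼fc : ∀ {G H} {z : GraphΣ.V G} {z′ : GraphΣ.V H} →
          _∼fc_ {G} {H} z z′ → Bot G z ⇔ Bot H z′
bot-∼fc (_ , B , s) = bot-invariant B s

bot-≈Σ : ∀ {G H} {z : GraphΣ.V G} {z′ : GraphΣ.V H} →
         _≈Σ_ {G} {H} z z′ → Bot G z ⇔ Bot H z′
bot-≈Σ (_ , B , s) = bot-invariant (weak⇒strong B) s

weaklyFair-flip : ∀ {G H TG TH R} → WeaklyFair G H TG TH R →
                  WeaklyFair H G TH TG (flip R)
weaklyFair-flip {G} {H} {TG} {TH} {R} W = record
  { coh-iff    = λ r r′ → ⇔.sym (coh-iff r r′)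
  ; total      = surjective
  ; surjective = total
  ; weak-bisim = λ r → ≈Σ-flip (weak-bisim r)
  ; test-rel   = test-rel-flip
  }
  where
  open WeaklyFair W

  ≈Σ-flip : ∀ {x y} → _≈Σ_ {G} {H} x y → _≈Σ_ {H} {G} y x
  ≈Σ-flip (S , (fwd , bwd) , s) = flip S , (bwd , fwd) , s

  test-rel-flip : ∀ {y x y′ x′} → R x y → R x′ y′ → TH.Coh y y′ →
                  ∃[ v ] ∃[ u ] (TH.test v y y′ × TG.test u x x′ × R u v)
  test-rel-flip r r′ c with test-rel r r′ (Equivalence.from (coh-iff r r′) c)
  ... | u , v , tu , tv , ruv = v , u , tv , tu , ruv

module _ {G H : GraphΣ} {TG : Testing G} {TH : Testing H}
         {R : GraphΣ.V G → GraphΣ.V H → Set} (W : WeaklyFair G H TG TH R) where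
  open WeaklyFair W
  module CohG = IsEquivalence TG.coh-equiv
  module CohH = IsEquivalence TH.coh-equiv
  open SetoidReasoning (⇔.⇔-setoid 0ℓ)

  -- The chosen test results of R-related coherent pairs agree on ⊥: clause (iv)
  -- gives R-related elements u ∈ (a | z), v ∈ (b | w), which are ∼fc to the
  -- chosen ones and weakly bisimilar to each other.
  bot-sel-related : ∀ {a b z w} → R a b → R z w → TG.Coh a z → TH.Coh b w →
                    Bot G (TG.sel a z) ⇔ Bot H (TH.sel b w)
  bot-sel-related {a} {b} {z} {w} rab rzw cohG cohH with test-rel rab rzw cohG
  ... | u , v , tu , tv , ruv = begin
    Bot G (TG.sel a z) ≈⟨ bot-∼fc (TG.test-bisim (TG.sel-spec cohG) tu) ⟩
    Bot G u            ≈⟨ bot-≈Σ (weak-bisim ruv) ⟩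
    Bot H v            ≈⟨ bot-∼fc (TH.test-bisim tv (TH.sel-spec cohH)) ⟩
    Bot H (TH.sel b w) ∎

  -- Fair testing equivalence is transported along R from G to H: a test w of
  -- y is reflected through R to a test z of x, where the hypothesis applies.
  fairEq-transport : ∀ {x x′ y y′} → R x y → R x′ y′ →
                     FairEq G TG x x′ → FairEq H TH y y′
  fairEq-transport {x} {x′} {y} {y′} r r′ (cohxx′ , fair) = cohyy′ , fairH
    where
    cohyy′ : TH.Coh y y′
    cohyy′ = Equivalence.to (coh-iff r r′) cohxx′

    fairH : ∀ w → TH.Coh w y → Bot H (TH.sel y w) ⇔ Bot H (TH.sel y′ w)
    fairH w cohwy with surjective w
    ... | z , rzw = begin
      Bot H (TH.sel y w)  ≈⟨ ⇔.sym (bot-sel-related r rzw cohxz cohyw) ⟩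
      Bot G (TG.sel x z)  ≈⟨ fair z cohzx ⟩
      Bot G (TG.sel x′ z) ≈⟨ bot-sel-related r′ rzw cohx′z cohy′w ⟩
      Bot H (TH.sel y′ w) ∎
      where
      cohzx : TG.Coh z x
      cohzx = Equivalence.from (coh-iff rzw r) cohwy
      cohxz : TG.Coh x z
      cohxz = CohG.sym cohzx
      cohx′z : TG.Coh x′ z
      cohx′z = CohG.trans (CohG.sym cohxx′) cohxz
      cohyw : TH.Coh y w
      cohyw = CohH.sym cohwy
      cohy′w : TH.Coh y′ w
      cohy′w = CohH.trans (CohH.sym cohyy′) cohyw

corollary2p25 : (G H : GraphΣ) (TG : Testing G) (TH : Testing H)
                (R : GraphΣ.V G → GraphΣ.V H → Set) → WeaklyFair G H TG TH R →
                ∀ {x x′ y y′} → R x y → R x′ y′ →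
                (FairEq G TG x x′ ⇔ FairEq H TH y y′)
corollary2p25 G H TG TH R W r r′ =
  mk⇔ (fairEq-transport W r r′) (fairEq-transport (weaklyFair-flip W) r r′)
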